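{- Let $p>2$ be a prime and let $\alpha\in\mathbb{Q}_p$ be a quadratic irrational over $\mathbb{Q}$ with $\alpha+\alpha^c=0$ and $v_p(\alpha)<0$, whose Browkin continued fraction expansion is periodic of the form $\alpha=[a_0,\overline{a_1,a_2,\dots,a_{d-1},2a_0}]$ with period length $d\ge1$, where $|a_0|_\infty<p/4$ and $a_{d-j}=a_j$ for $j=1,\dots,d-1$. Let $A_n,B_n$ be the convergent numerators and denominators of this expansion. Then: (i) if $d=2t$ is even, $a_0A_{d-1}+A_{d-2}=A_{t-1}(A_t+A_{t-2})$ and $B_{d-1}=B_{t-1}(B_t+B_{t-2})$; (ii) if $d=2t+1$ is odd, $a_0A_{d-1}+A_{d-2}=A_t^2+A_{t-1}^2$ and $B_{d-1}=B_t^2+B_{t-1}^2$.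
   Context: Let $\mathcal{Y}=\mathbb{Z}[1/p]\cap(-p/2,p/2)$; for $\gamma\in\mathbb{Q}_p$, $s(\gamma)$ is the unique element of $\mathcal{Y}$ with $|\gamma-s(\gamma)|_p<1$. The Browkin continued fraction of $\alpha$ is obtained by $\alpha_0=\alpha$, $a_n=s(\alpha_n)$, $\alpha_{n+1}=1/(\alpha_n-a_n)$. $\alpha^c$ is the conjugate of $\alpha$ over $\mathbb{Q}$. The convergent sequences are $A_{ -1}=1$, $A_0=a_0$, $B_{ -1}=0$, $B_0=1$, $A_n=a_nA_{n-1}+A_{n-2}$, $B_n=a_nB_{n-1}+B_{n-2}$ for $n\ge1$. -}

module Defs where

open import Data.Nat as ℕ using (ℕ; zero; suc; _^_)
open import Data.Nat.Divisibility using (_∣_)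
open import Data.Integer as ℤ using (ℤ; +_)
open import Data.Rational as ℚ using (ℚ; ↥_; ↧ₙ_; _/_; _+_; _*_; _-_; -_; _<_; 1ℚ; 0ℚ)
open import Data.Product using (Σ; ∃; _×_; _,_)
open import Relation.Binary.PropositionalEquality using (_≡_)
open import Relation.Nullary using (¬_)

ℕ→ℚ : ℕ → ℚ
ℕ→ℚ n = (+ n) / 1

-- p-adic valuation on ℚ (reduced form):  v_p(x) ≥ k   for k ∈ ℕ.
-- (x = n/d reduced; v_p(x) ≥ k iff p ∤ d and p^k ∣ n; note 0 = 0/1.)
vₚ≥ : (p : ℕ) → ℕ → ℚ → Set
vₚ≥ p k x = (¬ (p ∣ ↧ₙ x)) × ((p ^ k) ∣ ℤ.∣ ↥ x ∣)

Eventually : (ℕ → Set) → Set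
Eventually P = ∃ λ K → ∀ k → K ℕ.≤ k → P k

-- A p-adic square root of D ∈ ℚ, presented as a p-adically Cauchy sequence
-- of rationals r with  v_p(r_{k+1} - r_k) ≥ k  and  v_p(r_k² - D) ≥ k.
-- Its limit α ∈ ℚ_p satisfies α² = D.
record PAdicSqrt (p : ℕ) (D : ℚ) : Set where
  field
    r      : ℕ → ℚ
    cauchy : ∀ k → vₚ≥ p k (r (suc k) - r k)
    square : ∀ k → vₚ≥ p k (r k * r k - D)

-- Elements x + y·√D of the quadratic field ℚ(√D)
record QD : Set where
  constructor _+_√
  field
    re : ℚ
    im : ℚ
open QD public

subℚ : QD → ℚ → QD
subℚ (x + y √) a = (x - a) + y √

mulQD : ℚ → QD → QD → QD
mulQD D (x₁ + y₁ √) (x₂ + y₂ √) = (x₁ * x₂ + D * (y₁ * y₂)) + (x₁ * y₂ + x₂ * y₁) √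

oneQD : QD
oneQD = 1ℚ + 0ℚ √

-- |γ|_p < 1 for γ = x + y·α ∈ ℚ_p, where α = lim r_k is the chosen p-adic root.
-- Since {v_p ≥ 1} is clopen in ℚ_p, this holds iff it holds eventually along x + y·r_k.
SmallAt : (p : ℕ) {D : ℚ} → PAdicSqrt p D → QD → Set
SmallAt p R (x + y √) = Eventually λ k → vₚ≥ p 1 (x + y * PAdicSqrt.r R k)

NegVal : (p : ℕ) {D : ℚ} → PAdicSqrt p D → Set
NegVal p R = Eventually λ k → p ∣ ↧ₙ (PAdicSqrt.r R k)

InY : ℕ → ℚ → Set
InY p a = (∃ λ m → ↧ₙ a ≡ p ^ m) × ((- ℕ→ℚ p) < ℕ→ℚ 2 * a) × (ℕ→ℚ 2 * a < ℕ→ℚ p)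

-- The Browkin continued fraction of α = lim r_k (an element √D of ℚ(√D) ⊂ ℚ_p)
-- has partial quotients a : there are complete quotients αₙ ∈ ℚ(√D) with
-- α₀ = α, aₙ = s(αₙ) (i.e. aₙ ∈ 𝒴 and |αₙ - aₙ|_p < 1), αₙ₊₁ (αₙ - aₙ) = 1.
BrowkinCF : (p : ℕ) {D : ℚ} → PAdicSqrt p D → (ℕ → ℚ) → Set
BrowkinCF p {D} R a =
  Σ (ℕ → QD) λ α →
    (α 0 ≡ (0ℚ + 1ℚ √)) ×
    (∀ n → InY p (a n) × SmallAt p R (subℚ (α n) (a n))) ×
    (∀ n → mulQD D (α (suc n)) (subℚ (α n) (a n)) ≡ oneQD)

-- Convergents, shifted by one:  Aₛ a n = A_{n-1},  Bₛ a n = B_{n-1}.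
Aₛ : (ℕ → ℚ) → ℕ → ℚ
Aₛ a zero = 1ℚ
Aₛ a (suc zero) = a 0
Aₛ a (suc (suc n)) = a (suc n) * Aₛ a (suc n) + Aₛ a n

Bₛ : (ℕ → ℚ) → ℕ → ℚ
Bₛ a zero = 0ℚ
Bₛ a (suc zero) = 1ℚ
Bₛ a (suc (suc n)) = a (suc n) * Bₛ a (suc n) + Bₛ a n

-- Bₛ x (suc n) is the continuant K(x₁, …, xₙ) and Aₛ a n = K(a₀, …, aₙ₋₁).
-- Continuants are invariant under reversal of the word and satisfy
-- K(uv) = K(u) K(v) + K(u⁻) K(⁻v), where u⁻ drops the last letter of u and ⁻v
-- the first letter of v. Cutting a palindrome in the middle, reversal turns
-- every factor into the continuant of a prefix, which gives both identities:
-- B_{d-1} = K(a₁, …, a_{d-1}) and a₀ A_{d-1} + A_{d-2} = K(a₀, a₁, …, a_{d-1}, a₀)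
-- are continuants of palindromes because a_{d-j} = a_j.

module Submission where

open import Defs
open import Data.Nat as ℕ using (ℕ; zero; suc; _∸_; _%_; s≤s; z≤n)
open import Data.Nat.DivMod using (m<n⇒m%n≡m; n%n≡0)
open import Data.Nat.Primality using (Prime)
open import Data.Nat.Properties
  using (+-suc; +-comm; +-assoc; suc-injective; m≤m+n; m≤n+m; m+n∸n≡m; m<n⇒m<1+n;
         ≤-refl; <-≤-trans; n≤1+n; ≤-trans)
open import Data.Nat.Tactic.RingSolver using (solve-∀)
open import Data.Product using (_×_; _,_)
open import Data.Rational as ℚ using (ℚ; _+_; _*_; -_; _<_; 0ℚ; 1ℚ)
open import Data.Rational.Properties
  using (*-distribˡ-+; *-identityʳ; *-identityˡ; *-zeroʳ; *-comm; +-identityʳ)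
open import Data.Rational.Solver using (module +-*-Solver)
open import Function using (_∘_)
open import Relation.Binary.PropositionalEquality
  using (_≡_; _≢_; refl; sym; trans; cong; cong₂; subst; module ≡-Reasoning)

open ≡-Reasoning

shift : ℕ → (ℕ → ℚ) → ℕ → ℚ
shift k x i = x (k ℕ.+ i)

Reverses : ℕ → (ℕ → ℚ) → (ℕ → ℚ) → Set
Reverses n x y = ∀ i j → suc (i ℕ.+ j) ≡ n → x (suc i) ≡ y (suc j)

Palindrome : ℕ → (ℕ → ℚ) → Set
Palindrome n x = Reverses n x x

Bₛ-two : ∀ x → Bₛ x 2 ≡ x 1
Bₛ-two x = trans (+-identityʳ (x 1 * 1ℚ)) (*-identityʳ (x 1))

Bₛ-split : ∀ x k n → Bₛ x (n ℕ.+ suc k) ≡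
           Bₛ x (suc k) * Bₛ (shift k x) (suc n) + Bₛ x k * Bₛ (shift (suc k) x) n
Bₛ-split x k zero = sym (begin
    Bₛ x (suc k) * 1ℚ + Bₛ x k * 0ℚ
      ≡⟨ cong₂ _+_ (*-identityʳ (Bₛ x (suc k))) (*-zeroʳ (Bₛ x k)) ⟩
    Bₛ x (suc k) + 0ℚ
      ≡⟨ +-identityʳ (Bₛ x (suc k)) ⟩
    Bₛ x (suc k) ∎)
Bₛ-split x k (suc zero) = begin
    x (suc k) * Bₛ x (suc k) + Bₛ x k
      ≡⟨ cong₂ _+_ (*-comm (x (suc k)) (Bₛ x (suc k))) (sym (*-identityʳ (Bₛ x k))) ⟩
    Bₛ x (suc k) * x (suc k) + Bₛ x k * 1ℚ
      ≡⟨ cong (λ u → Bₛ x (suc k) * u + Bₛ x k * 1ℚ)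
              (sym (trans (Bₛ-two (shift k x)) (cong x (+-comm k 1)))) ⟩
    Bₛ x (suc k) * Bₛ (shift k x) 2 + Bₛ x k * 1ℚ ∎
Bₛ-split x k (suc (suc n)) = begin
    e * Bₛ x (suc n ℕ.+ suc k) + Bₛ x (n ℕ.+ suc k)
      ≡⟨ cong₂ (λ u v → e * u + v) (Bₛ-split x k (suc n)) (Bₛ-split x k n) ⟩
    e * (P * Q₁ + R * S₁) + (P * Q₀ + R * S₀)
      ≡⟨ regroup e P Q₁ Q₀ R S₁ S₀ ⟩
    P * (e * Q₁ + Q₀) + R * (e * S₁ + S₀)
      ≡⟨ cong₂ (λ u v → P * (u * Q₁ + Q₀) + R * (v * S₁ + S₀))
               (cong x (index₁ n k)) (cong x (index₂ n k)) ⟩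
    P * Bₛ (shift k x) (suc (suc (suc n))) + R * Bₛ (shift (suc k) x) (suc (suc n)) ∎
  where
  e = x (suc (n ℕ.+ suc k))
  P = Bₛ x (suc k)
  R = Bₛ x k
  Q₁ = Bₛ (shift k x) (suc (suc n))
  Q₀ = Bₛ (shift k x) (suc n)
  S₁ = Bₛ (shift (suc k) x) (suc n)
  S₀ = Bₛ (shift (suc k) x) n
  regroup : ∀ e P Q₁ Q₀ R S₁ S₀ →
            e * (P * Q₁ + R * S₁) + (P * Q₀ + R * S₀) ≡ P * (e * Q₁ + Q₀) + R * (e * S₁ + S₀)
  regroup = +-*-Solver.solve 7 (λ e P Q₁ Q₀ R S₁ S₀ →
    e :* (P :* Q₁ :+ R :* S₁) :+ (P :* Q₀ :+ R :* S₀) := P :* (e :* Q₁ :+ Q₀) :+ R :* (e :* S₁ :+ S₀)) refl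
    where open +-*-Solver
  index₁ : ∀ n k → suc (n ℕ.+ suc k) ≡ k ℕ.+ suc (suc n)
  index₁ = solve-∀
  index₂ : ∀ n k → suc (n ℕ.+ suc k) ≡ suc (k ℕ.+ suc n)
  index₂ = solve-∀

Bₛ-unfoldˡ : ∀ x n → Bₛ x (suc (suc n)) ≡ x 1 * Bₛ (shift 1 x) (suc n) + Bₛ (shift 2 x) n
Bₛ-unfoldˡ x n = begin
  Bₛ x (suc (suc n))
    ≡⟨ cong (Bₛ x) (+-comm 2 n) ⟩
  Bₛ x (n ℕ.+ 2)
    ≡⟨ Bₛ-split x 1 n ⟩
  Bₛ x 2 * Bₛ (shift 1 x) (suc n) + 1ℚ * Bₛ (shift 2 x) n
    ≡⟨ cong₂ (λ u v → u * Bₛ (shift 1 x) (suc n) + v) (Bₛ-two x) (*-identityˡ (Bₛ (shift 2 x) n)) ⟩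
  x 1 * Bₛ (shift 1 x) (suc n) + Bₛ (shift 2 x) n ∎

Bₛ-reverse : ∀ n {x y} → Reverses n x y → Bₛ x (suc n) ≡ Bₛ y (suc n)
Bₛ-reverse zero rev = refl
Bₛ-reverse (suc zero) rev = cong (λ u → u * 1ℚ + 0ℚ) (rev 0 0 refl)
Bₛ-reverse (suc (suc n)) {x} {y} rev = begin
  Bₛ x (suc (suc (suc n)))
    ≡⟨ Bₛ-unfoldˡ x (suc n) ⟩
  x 1 * Bₛ (shift 1 x) (suc (suc n)) + Bₛ (shift 2 x) (suc n)
    ≡⟨ cong₂ _+_ (cong₂ _*_ (rev 0 (suc n) refl) (Bₛ-reverse (suc n) {shift 1 x} {y} drop₁))
                 (Bₛ-reverse n {shift 2 x} {y} drop₂) ⟩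
  y (suc (suc n)) * Bₛ y (suc (suc n)) + Bₛ y (suc n)
    ∎
  where
  drop₁ : Reverses (suc n) (shift 1 x) y
  drop₁ i j e = rev (suc i) j (cong suc e)
  drop₂ : Reverses n (shift 2 x) y
  drop₂ i j e = rev (suc (suc i)) j (cong (suc ∘ suc) e)

palindrome-suffix : ∀ {n} x k m → k ℕ.+ m ≡ n → Palindrome n x → Reverses m (shift k x) x
palindrome-suffix {n} x k m k+m≡n pal i j 1+i+j≡m =
  trans (cong x (+-suc k i)) (pal (k ℕ.+ i) j (begin
    suc (k ℕ.+ i ℕ.+ j)    ≡⟨ cong suc (+-assoc k i j) ⟩
    suc (k ℕ.+ (i ℕ.+ j))  ≡⟨ sym (+-suc k (i ℕ.+ j)) ⟩
    k ℕ.+ suc (i ℕ.+ j)    ≡⟨ cong (k ℕ.+_) 1+i+j≡m ⟩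
    k ℕ.+ m                ≡⟨ k+m≡n ⟩
    n                      ∎))

Bₛ-palindrome-suffix : ∀ {n} x k m → k ℕ.+ m ≡ n → Palindrome n x →
                       Bₛ (shift k x) (suc m) ≡ Bₛ x (suc m)
Bₛ-palindrome-suffix x k m k+m≡n pal = Bₛ-reverse m (palindrome-suffix x k m k+m≡n pal)

Bₛ-palindrome-odd : ∀ {n} x t → n ≡ suc (2 ℕ.* t) → Palindrome n x →
                    Bₛ x (suc n) ≡ Bₛ x (suc t) * (Bₛ x (suc (suc t)) + Bₛ x t)
Bₛ-palindrome-odd x t refl pal = begin
  Bₛ x (suc (suc (2 ℕ.* t)))                    ≡⟨ cong (Bₛ x) (lengths t) ⟩
  Bₛ x (suc t ℕ.+ suc t)                        ≡⟨ Bₛ-split x t (suc t) ⟩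
  Bₛ x (suc t) * Bₛ (shift t x) (suc (suc t)) + Bₛ x t * Bₛ (shift (suc t) x) (suc t)
    ≡⟨ cong₂ (λ u v → Bₛ x (suc t) * u + Bₛ x t * v)
             (Bₛ-palindrome-suffix x t (suc t) (left t) pal)
             (Bₛ-palindrome-suffix x (suc t) t (right t) pal) ⟩
  Bₛ x (suc t) * Bₛ x (suc (suc t)) + Bₛ x t * Bₛ x (suc t)
    ≡⟨ factor (Bₛ x (suc t)) (Bₛ x (suc (suc t))) (Bₛ x t) ⟩
  Bₛ x (suc t) * (Bₛ x (suc (suc t)) + Bₛ x t)  ∎
  where
  factor : ∀ P Q R → P * Q + R * P ≡ P * (Q + R)
  factor P Q R = trans (cong (P * Q +_) (*-comm R P)) (sym (*-distribˡ-+ P Q R))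
  lengths : ∀ t → suc (suc (2 ℕ.* t)) ≡ suc t ℕ.+ suc t
  lengths = solve-∀
  left : ∀ t → t ℕ.+ suc t ≡ suc (2 ℕ.* t)
  left = solve-∀
  right : ∀ t → suc t ℕ.+ t ≡ suc (2 ℕ.* t)
  right = solve-∀

Bₛ-palindrome-even : ∀ {n} x t → n ≡ 2 ℕ.* t → Palindrome n x →
                     Bₛ x (suc n) ≡ Bₛ x (suc t) * Bₛ x (suc t) + Bₛ x t * Bₛ x t
Bₛ-palindrome-even x zero refl pal = refl
Bₛ-palindrome-even x t@(suc u) refl pal = begin
  Bₛ x (suc (2 ℕ.* t))                          ≡⟨ cong (Bₛ x) (lengths u) ⟩
  Bₛ x (t ℕ.+ suc t)                            ≡⟨ Bₛ-split x t t ⟩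
  Bₛ x (suc t) * Bₛ (shift t x) (suc t) + Bₛ x t * Bₛ (shift (suc t) x) t
    ≡⟨ cong₂ (λ u v → Bₛ x (suc t) * u + Bₛ x t * v)
             (Bₛ-palindrome-suffix x t t (left u) pal)
             (Bₛ-palindrome-suffix x (suc t) u (right u) pal) ⟩
  Bₛ x (suc t) * Bₛ x (suc t) + Bₛ x t * Bₛ x t ∎
  where
  lengths : ∀ u → suc (2 ℕ.* suc u) ≡ suc u ℕ.+ suc (suc u)
  lengths = solve-∀
  left : ∀ u → suc u ℕ.+ suc u ≡ 2 ℕ.* suc u
  left = solve-∀
  right : ∀ u → suc (suc u) ℕ.+ u ≡ 2 ℕ.* suc u
  right = solve-∀

cycle : ℕ → (ℕ → ℚ) → ℕ → ℚ
cycle n a i = a (i % suc n)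

cycle-< : ∀ {n i} a → i ℕ.< suc n → cycle n a i ≡ a i
cycle-< a i<1+n = cong a (m<n⇒m%n≡m i<1+n)

cycle-period : ∀ n a → cycle n a (suc n) ≡ a 0
cycle-period n a = cong a (n%n≡0 (suc n))

cycle-palindrome : ∀ {n} a → Palindrome n a → Palindrome (suc (suc n)) (cycle n a ∘ ℕ.pred)
cycle-palindrome {n} a pal i j e = mirror i j (suc-injective e)
  where
  mirror : ∀ i j → i ℕ.+ j ≡ suc n → cycle n a i ≡ cycle n a j
  mirror zero j j≡1+n = trans (sym (cycle-period n a)) (cong (cycle n a) (sym j≡1+n))
  mirror (suc i) zero e = sym (mirror zero (suc i) (trans (+-comm 0 (suc i)) e))
  mirror (suc i) (suc j) e = begin
    cycle n a (suc i)  ≡⟨ cycle-< a (s≤s 1+i≤n) ⟩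
    a (suc i)          ≡⟨ pal i j 1+i+j≡n ⟩
    a (suc j)          ≡⟨ cycle-< a (s≤s 1+j≤n) ⟨
    cycle n a (suc j)  ∎
    where
    1+i+j≡n : suc (i ℕ.+ j) ≡ n
    1+i+j≡n = trans (sym (+-suc i j)) (suc-injective e)
    1+i≤n : suc i ℕ.≤ n
    1+i≤n = subst (suc i ℕ.≤_) 1+i+j≡n (s≤s (m≤m+n i j))
    1+j≤n : suc j ℕ.≤ n
    1+j≤n = subst (suc j ℕ.≤_) 1+i+j≡n (s≤s (m≤n+m j i))

palindrome-of-reflection : ∀ {n} a → (∀ j → 1 ℕ.≤ j → j ℕ.< suc n → a (suc n ∸ j) ≡ a j) →
                           Palindrome n a
palindrome-of-reflection {n} a reflection i j 1+i+j≡n =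
  trans (cong a (sym n-j≡1+i)) (reflection (suc j) (s≤s z≤n) (s≤s 1+j≤n))
  where
  n-j≡1+i : n ∸ j ≡ suc i
  n-j≡1+i = trans (cong (_∸ j) (sym 1+i+j≡n)) (m+n∸n≡m (suc i) j)
  1+j≤n : suc j ℕ.≤ n
  1+j≤n = subst (suc j ℕ.≤_) 1+i+j≡n (s≤s (m≤n+m j i))

Aₛ-cong : ∀ {a b} n → (∀ i → i ℕ.< n → a i ≡ b i) → Aₛ a n ≡ Aₛ b n
Aₛ-cong zero a≗b = refl
Aₛ-cong (suc zero) a≗b = a≗b 0 (s≤s z≤n)
Aₛ-cong (suc (suc n)) a≗b =
  cong₂ _+_ (cong₂ _*_ (a≗b (suc n) ≤-refl) (Aₛ-cong (suc n) (λ i i<1+n → a≗b i (m<n⇒m<1+n i<1+n))))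
            (Aₛ-cong n (λ i i<n → a≗b i (m<n⇒m<1+n (m<n⇒m<1+n i<n))))

Aₛ-as-Bₛ : ∀ a n → Aₛ a n ≡ Bₛ (a ∘ ℕ.pred) (suc n)
Aₛ-as-Bₛ a zero = refl
Aₛ-as-Bₛ a (suc zero) = sym (Bₛ-two (a ∘ ℕ.pred))
Aₛ-as-Bₛ a (suc (suc n)) = cong₂ (λ u v → a (suc n) * u + v) (Aₛ-as-Bₛ a (suc n)) (Aₛ-as-Bₛ a n)

Aₛ-cycle : ∀ n {m} a → m ℕ.≤ suc n → Aₛ a m ≡ Bₛ (cycle n a ∘ ℕ.pred) (suc m)
Aₛ-cycle n {m} a m≤1+n = trans (Aₛ-cong m (λ i i<m → sym (cycle-< a (<-≤-trans i<m m≤1+n))))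
                                 (Aₛ-as-Bₛ (cycle n a) m)

-- Positions 1, …, n + 2 of cycle n a ∘ pred spell the word a₀ a₁ … aₙ a₀.
Aₛ-closing : ∀ n a → a 0 * Aₛ a (suc n) + Aₛ a n ≡ Bₛ (cycle n a ∘ ℕ.pred) (suc (suc (suc n)))
Aₛ-closing n a = begin
  a 0 * Aₛ a (suc n) + Aₛ a n
    ≡⟨ cong₂ (λ u v → a 0 * u + v) (Aₛ-cycle n a ≤-refl) (Aₛ-cycle n a (n≤1+n n)) ⟩
  a 0 * Bₛ z (suc (suc n)) + Bₛ z (suc n)
    ≡⟨ cong (λ c → c * Bₛ z (suc (suc n)) + Bₛ z (suc n)) (cycle-period n a) ⟨
  Bₛ z (suc (suc (suc n))) ∎
  where
  z = cycle n a ∘ ℕ.pred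

Aₛ-closing-even-period : ∀ {n} a u → n ≡ suc (2 ℕ.* u) → Palindrome n a →
                         a 0 * Aₛ a (suc n) + Aₛ a n ≡ Aₛ a (suc u) * (Aₛ a (suc (suc u)) + Aₛ a u)
Aₛ-closing-even-period {n} a u refl pal = begin
  a 0 * Aₛ a (suc n) + Aₛ a n
    ≡⟨ Aₛ-closing n a ⟩
  Bₛ z (suc (suc (suc n)))
    ≡⟨ Bₛ-palindrome-odd z (suc u) (length u) (cycle-palindrome a pal) ⟩
  Bₛ z (suc (suc u)) * (Bₛ z (suc (suc (suc u))) + Bₛ z (suc u))
    ≡⟨ cong₂ _*_ (Aₛ-cycle n a 1+u≤1+n) (cong₂ _+_ (Aₛ-cycle n a 2+u≤1+n) (Aₛ-cycle n a u≤1+n)) ⟨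
  Aₛ a (suc u) * (Aₛ a (suc (suc u)) + Aₛ a u) ∎
  where
  z = cycle n a ∘ ℕ.pred
  length : ∀ u → suc (suc (suc (2 ℕ.* u))) ≡ suc (2 ℕ.* suc u)
  length = solve-∀
  2+u≤1+n : suc (suc u) ℕ.≤ suc n
  2+u≤1+n = s≤s (s≤s (m≤m+n u (u ℕ.+ 0)))
  1+u≤1+n : suc u ℕ.≤ suc n
  1+u≤1+n = ≤-trans (n≤1+n (suc u)) 2+u≤1+n
  u≤1+n : u ℕ.≤ suc n
  u≤1+n = ≤-trans (n≤1+n u) 1+u≤1+n

Aₛ-closing-odd-period : ∀ {n} a t → n ≡ 2 ℕ.* t → Palindrome n a →
                        a 0 * Aₛ a (suc n) + Aₛ a n ≡ Aₛ a (suc t) * Aₛ a (suc t) + Aₛ a t * Aₛ a t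
Aₛ-closing-odd-period {n} a t refl pal = begin
  a 0 * Aₛ a (suc n) + Aₛ a n
    ≡⟨ Aₛ-closing n a ⟩
  Bₛ z (suc (suc (suc n)))
    ≡⟨ Bₛ-palindrome-even z (suc t) (length t) (cycle-palindrome a pal) ⟩
  Bₛ z (suc (suc t)) * Bₛ z (suc (suc t)) + Bₛ z (suc t) * Bₛ z (suc t)
    ≡⟨ cong₂ (λ P Q → P * P + Q * Q) (Aₛ-cycle n a 1+t≤1+n) (Aₛ-cycle n a t≤1+n) ⟨
  Aₛ a (suc t) * Aₛ a (suc t) + Aₛ a t * Aₛ a t                   ∎
  where
  z = cycle n a ∘ ℕ.pred
  length : ∀ t → suc (suc (2 ℕ.* t)) ≡ 2 ℕ.* suc t
  length = solve-∀
  1+t≤1+n : suc t ℕ.≤ suc n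
  1+t≤1+n = s≤s (m≤m+n t (t ℕ.+ 0))
  t≤1+n : t ℕ.≤ suc n
  t≤1+n = ≤-trans (n≤1+n t) 1+t≤1+n

proposition5p1 :
    (p : ℕ) → Prime p → 2 ℕ.< p →
    (D : ℚ) → (∀ q → q * q ≢ D) →
    (R : PAdicSqrt p D) → NegVal p R →
    (a : ℕ → ℚ) → BrowkinCF p R a →
    (d : ℕ) → 1 ℕ.≤ d →
    (∀ n → 1 ℕ.≤ n → a (n ℕ.+ d) ≡ a n) →
    a d ≡ ℕ→ℚ 2 * a 0 →
    (∀ j → 1 ℕ.≤ j → j ℕ.< d → a (d ∸ j) ≡ a j) →
    (- ℕ→ℚ p) < ℕ→ℚ 4 * a 0 → ℕ→ℚ 4 * a 0 < ℕ→ℚ p →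
    ((t : ℕ) → d ≡ 2 ℕ.* t →
      (a 0 * Aₛ a d + Aₛ a (d ∸ 1) ≡ Aₛ a t * (Aₛ a (suc t) + Aₛ a (t ∸ 1)))
      × (Bₛ a d ≡ Bₛ a t * (Bₛ a (suc t) + Bₛ a (t ∸ 1))))
    × ((t : ℕ) → d ≡ 2 ℕ.* t ℕ.+ 1 →
      (a 0 * Aₛ a d + Aₛ a (d ∸ 1) ≡ Aₛ a (suc t) * Aₛ a (suc t) + Aₛ a t * Aₛ a t)
      × (Bₛ a d ≡ Bₛ a (suc t) * Bₛ a (suc t) + Bₛ a t * Bₛ a t))
proposition5p1 _ _ _ _ _ _ _ _ _ zero () _ _ _ _ _
proposition5p1 _ _ _ _ _ _ _ a _ (suc n) _ _ _ reflection _ _ =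
    (λ { zero ()
       ; (suc u) d≡2t → let n≡1+2u = suc-injective (trans d≡2t (2*[1+u] u)) in
           Aₛ-closing-even-period a u n≡1+2u inner , Bₛ-palindrome-odd a u n≡1+2u inner })
  , (λ t d≡2t+1 → let n≡2t = suc-injective (trans d≡2t+1 (+-comm (2 ℕ.* t) 1)) in
           Aₛ-closing-odd-period a t n≡2t inner , Bₛ-palindrome-even a t n≡2t inner)
  where
  inner : Palindrome n a
  inner = palindrome-of-reflection a reflection
  2*[1+u] : ∀ u → 2 ℕ.* suc u ≡ suc (suc (2 ℕ.* u))
  2*[1+u] = solve-∀
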